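{- Let $(\mathcal{G},v)$ be a pointed concurrent game structure with imperfect information and let $v'$ be a position reachable from $v$ in $\mathcal{G}$. If $(\mathcal{G},v)$ has hierarchical observation (resp. yields static, dynamic, or recurring hierarchical information), then so does $(\mathcal{G},v')$.
   Context: A CGS is $\mathcal{G}=(V,\delta,\ell,\{\sim_a\}_{a\in Ag})$ with $V$ a finite nonempty set of positions, $\delta:V\times Mov^{Ag}\to V$ a transition function ($Mov$ a finite set of moves; for nondeterministic CGS, $\delta\subseteq V\times Mov^{Ag}\times V$), $\ell$ a labelling, and equivalence relations $\sim_a$ on $V$ for each agent $a$. Plays are sequences of positions where consecutive positions are linked by some joint move; $\mathrm{FPlay}(\mathcal{G},v)$ is the set of finite plays starting in $v$. Finite plays $\rho\sim_a\rho'$ iff they have equal length and are positionwise $\sim_a$-related. A CGS has hierarchical observation if there is a total preorder $\preceq$ on agents such that $a\preceq b$ and $u\sim_a u'$ imply $u\sim_b u'$. For $\rho\in\mathrm{FPlay}(\mathcal{G},v)$, $I_a(\rho)=\{\rho'\in\mathrm{FPlay}(\mathcal{G},v)\mid\rho\sim_a\rho'\}$; $\rho$ yields hierarchical information if there is a total preorder $\preceq$ on agents with $a\preceq b\Rightarrow I_a(\rho)\subseteq I_b(\rho)$. $(\mathcal{G},v)$ yields static hierarchical information if all finite plays from $v$ yield hierarchical information for one common preorder; dynamic if every finite play from $v$ yields hierarchical information (preorder possibly depending on the play); recurring if every infinite play from $v$ has infinitely many prefixes yielding hierarchical information. -}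

module Defs where

open import Data.Nat using (ℕ; zero; suc; _≤_)
open import Data.Fin using (Fin; toℕ)
open import Data.Bool using (Bool)
open import Data.List using (List; []; _∷_; tabulate)
open import Data.List.Relation.Binary.Pointwise using (Pointwise)
open import Data.Product using (Σ; ∃; _×_; _,_)
open import Relation.Binary using (Rel; IsEquivalence; IsTotalPreorder)
open import Relation.Binary.PropositionalEquality using (_≡_)
open import Relation.Binary.Construct.Closure.ReflexiveTransitive using (Star)
open import Relation.Unary using (Pred; _⊆_)
open import Level using (0ℓ)

record CGS (nAg nMov nV : ℕ) (AP : Set) : Set₁ where
  field
    δ        : Fin nV → (Fin nAg → Fin nMov) → Fin nV
    ℓ        : Fin nV → AP → Bool
    obs      : Fin nAg → Rel (Fin nV) 0ℓ
    obs-equiv : ∀ a → IsEquivalence (obs a)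

module _ {nAg nMov nV : ℕ} {AP : Set} (G : CGS nAg nMov nV AP) where
  open CGS G

  Pos : Set
  Pos = Fin nV

  Agent : Set
  Agent = Fin nAg

  Step : Rel Pos 0ℓ
  Step u w = ∃ λ (m : Fin nAg → Fin nMov) → δ u m ≡ w

  data Path : List Pos → Set where
    [_]  : ∀ u → Path (u ∷ [])
    step : ∀ {u w ws} → Step u w → Path (w ∷ ws) → Path (u ∷ w ∷ ws)

  FPlay : Pos → Pred (List Pos) 0ℓ
  FPlay v ρ = Σ (List Pos) λ ws → (ρ ≡ v ∷ ws) × Path ρ

  _≈[_]_ : List Pos → Agent → List Pos → Set
  ρ ≈[ a ] ρ' = Pointwise (obs a) ρ ρ'

  Info : Pos → Agent → List Pos → Pred (List Pos) 0ℓ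
  Info v a ρ ρ' = FPlay v ρ' × (ρ ≈[ a ] ρ')

  TotalPreorder : (Agent → Agent → Set) → Set
  TotalPreorder _≼_ = IsTotalPreorder _≡_ _≼_

  HierarchicalObservation : Set₁
  HierarchicalObservation =
    ∃ λ (_≼_ : Agent → Agent → Set) → TotalPreorder _≼_ ×
      (∀ a b → a ≼ b → ∀ u u' → obs a u u' → obs b u u')

  HierarchicalFor : Pos → (Agent → Agent → Set) → List Pos → Set
  HierarchicalFor v _≼_ ρ = ∀ a b → a ≼ b → Info v a ρ ⊆ Info v b ρ

  YieldsHI : Pos → List Pos → Set₁
  YieldsHI v ρ = ∃ λ (_≼_ : Agent → Agent → Set) → TotalPreorder _≼_ × HierarchicalFor v _≼_ ρ

  StaticHI : Pos → Set₁
  StaticHI v = ∃ λ (_≼_ : Agent → Agent → Set) → TotalPreorder _≼_ ×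
    (∀ ρ → FPlay v ρ → HierarchicalFor v _≼_ ρ)

  DynamicHI : Pos → Set₁
  DynamicHI v = ∀ ρ → FPlay v ρ → YieldsHI v ρ

  IsPlay : Pos → (ℕ → Pos) → Set
  IsPlay v π = (π 0 ≡ v) × (∀ i → Step (π i) (π (suc i)))

  -- prefix π(0)…π(n) of length n+1
  prefix : (ℕ → Pos) → ℕ → List Pos
  prefix π n = tabulate {n = suc n} (λ i → π (toℕ i))

  RecurringHI : Pos → Set₁
  RecurringHI v = ∀ π → IsPlay v π → ∀ n → ∃ λ m → (n ≤ m) × YieldsHI v (prefix π m)

  Reachable : Pos → Pos → Set
  Reachable = Star Step

module Submission where

-- Fix a path  v = u₀ → u₁ → … → uₖ = v'  witnessing reachability and
-- let  h = u₀ … uₖ₋₁  be its history.  Prepending h is a translation from plays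
-- rooted at v' to plays rooted at v, both for finite plays (ρ ↦ h ++ ρ) and for
-- infinite ones (π ↦ h · π, whose prefix of index k + m is h ++ (prefix of π of
-- index m)).  Since h is related to itself for every agent and a common prefix
-- can be cancelled from positionwise-related lists, the information sets satisfy
--   I_a(ρ) relative to v'  =  { ρ' | h ++ ρ' ∈ I_a(h ++ ρ) relative to v },
-- so every preorder under which h ++ ρ yields hierarchical information also
-- works for ρ.  The four claims then follow: hierarchical observation does not
-- mention the root at all; static and dynamic information transfer along
-- ρ ↦ h ++ ρ; recurring information transfers along π ↦ h · π, shifting the
-- indices of the good prefixes by k.

open import Defs
open import Data.Nat using (ℕ; zero; suc; _+_; _≤_)
open import Data.Nat.Properties using (m≤n⇒∃[o]m+o≡n; +-cancelˡ-≤; ≤-trans; m≤m+n)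
open import Data.Product using (_×_; _,_; ∃)
open import Data.List using (List; []; _∷_; _++_; length)
open import Data.List.Relation.Binary.Pointwise using (Pointwise; ++⁺; ++-cancelˡ)
  renaming (refl to pointwise-refl)
open import Relation.Binary.Construct.Closure.ReflexiveTransitive using (ε; _◅_)
open import Relation.Binary.PropositionalEquality using (_≡_; refl; sym; subst; cong)
open import Relation.Binary using (IsEquivalence)

prepend : {A : Set} → List A → (ℕ → A) → ℕ → A
prepend []       π i       = π i
prepend (x ∷ xs) π zero    = x
prepend (x ∷ xs) π (suc i) = prepend xs π i

module _ {nAg nMov nV : ℕ} {AP : Set} (G : CGS nAg nMov nV AP) where
  open CGS G

  history : ∀ {v v'} → Reachable G v v' → List (Pos G)
  history ε                = []
  history (_◅_ {i = v} _ r) = v ∷ history r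

  history-path : ∀ {v v' ws} (r : Reachable G v v') → Path G (v' ∷ ws) → Path G (history r ++ v' ∷ ws)
  history-path ε              p = p
  history-path (s ◅ ε)        p = step s p
  history-path (s ◅ (t ◅ r))  p = step s (history-path (t ◅ r) p)

  history-head : ∀ {v v'} (r : Reachable G v v') ws → ∃ λ ws' → history r ++ v' ∷ ws ≡ v ∷ ws'
  history-head ε       ws = ws , refl
  history-head (_ ◅ r) ws = history r ++ _ ∷ ws , refl

  history-fplay : ∀ {v v' ρ} (r : Reachable G v v') → FPlay G v' ρ → FPlay G v (history r ++ ρ)
  history-fplay r (ws , refl , p) =
    let ws' , eq = history-head r ws in ws' , eq , history-path r p

  ≈-prefix : ∀ {a} hs {ρ ρ'} → Pointwise (obs a) ρ ρ' → Pointwise (obs a) (hs ++ ρ) (hs ++ ρ')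
  ≈-prefix {a} hs = ++⁺ (pointwise-refl (IsEquivalence.refl (obs-equiv a)))

  hierarchical-transfer : ∀ {v v'} (r : Reachable G v v') _≼_ ρ →
    HierarchicalFor G v _≼_ (history r ++ ρ) → HierarchicalFor G v' _≼_ ρ
  hierarchical-transfer r _≼_ ρ H a b a≼b (fp , ρ≈ρ') =
    let _ , hρ≈hρ' = H a b a≼b (history-fplay r fp , ≈-prefix (history r) ρ≈ρ')
    in fp , ++-cancelˡ (history r) hρ≈hρ'

  yields-transfer : ∀ {v v'} (r : Reachable G v v') ρ → YieldsHI G v (history r ++ ρ) → YieldsHI G v' ρ
  yields-transfer r ρ (_≼_ , tp , H) = _≼_ , tp , hierarchical-transfer r _≼_ ρ H

  history-play : ∀ {v v'} (r : Reachable G v v') π → IsPlay G v' π → IsPlay G v (prepend (history r) π)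
  history-play ε       π play = play
  history-play (s ◅ r) π play with history-play r π play
  ... | start , steps = refl , λ { zero → subst (Step G _) (sym start) s ; (suc i) → steps i }

  prefix-prepend : ∀ hs π m → prefix G (prepend hs π) (length hs + m) ≡ hs ++ prefix G π m
  prefix-prepend []       π m = refl
  prefix-prepend (x ∷ xs) π m = cong (x ∷_) (prefix-prepend xs π m)

  -- Given a play π from v', look at the good prefixes of h · π beyond index
  -- |h| + n; each has index |h| + j with n ≤ j and equals h ++ (prefix π j).
  recurring-transfer : ∀ {v v'} → Reachable G v v' → RecurringHI G v → RecurringHI G v'
  recurring-transfer r R π play n
    with R (prepend (history r) π) (history-play r π play) (length (history r) + n)
  ... | m , k+n≤m , yields
    with m≤n⇒∃[o]m+o≡n (≤-trans (m≤m+n (length (history r)) n) k+n≤m)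
  ... | j , refl =
    j , +-cancelˡ-≤ (length (history r)) n j k+n≤m ,
    yields-transfer r (prefix G π j)
      (subst (YieldsHI G _) (prefix-prepend (history r) π j) yields)

proposition2 : ∀ {nAg nMov nV : ℕ} {AP : Set} (G : CGS nAg nMov nV AP) (v v' : Pos G) →
    Reachable G v v' →
    (HierarchicalObservation G → HierarchicalObservation G)
    × (StaticHI G v → StaticHI G v')
    × (DynamicHI G v → DynamicHI G v')
    × (RecurringHI G v → RecurringHI G v')
proposition2 G v v' r =
    (λ observation → observation)
  , (λ { (_≼_ , tp , H) → _≼_ , tp , λ ρ fp →
           hierarchical-transfer G r _≼_ ρ (H _ (history-fplay G r fp)) })
  , (λ D ρ fp → yields-transfer G r ρ (D _ (history-fplay G r fp)))
  , recurring-transfer G r
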